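{- Let $G$ be a simple undirected graph with $n\ge1$ vertices of degrees $k_1,\dots,k_n$ and $m$ edges, and write $n\langle k^2\rangle=\sum_{i=1}^n k_i^2$. Then for every linear arrangement of the vertices of $G$, the sum of edge lengths satisfies $$D\le m\left(n-\frac12\right)-\frac n4\langle k^2\rangle .$$ In particular the maximum $D_{max}$ of $D$ over all $n!$ linear arrangements satisfies the same bound.
   Context: A linear arrangement of the vertex set $V$ ($|V|=n$) is a bijection $\pi:V\to\{1,\dots,n\}$; the length of an edge $\{u,v\}$ is $|\pi(u)-\pi(v)|$; $D$ is the sum of the lengths of all edges. -}

module Defs where

open import Data.Nat using (ℕ; zero; suc; _+_; _*_; _<_; ∣_-_∣)
open import Data.Nat.Properties using (_<?_)
open import Data.Bool using (Bool; true; false; if_then_else_)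
open import Data.Fin using (Fin; toℕ) renaming (zero to fzero; suc to fsuc)
open import Data.Fin.Permutation using (Permutation′; _⟨$⟩ʳ_)
open import Relation.Binary.PropositionalEquality using (_≡_)
open import Relation.Nullary using (does)

sumFin : ∀ {n} → (Fin n → ℕ) → ℕ
sumFin {zero}  f = 0
sumFin {suc n} f = f fzero + sumFin (λ i → f (fsuc i))

record SimpleGraph (n : ℕ) : Set where
  field
    adj       : Fin n → Fin n → Bool
    symmetric : ∀ i j → adj i j ≡ adj j i
    irrefl    : ∀ i → adj i i ≡ false
open SimpleGraph public

𝟙 : Bool → ℕ
𝟙 true  = 1
𝟙 false = 0

degree : ∀ {n} → SimpleGraph n → Fin n → ℕ
degree G i = sumFin (λ j → 𝟙 (adj G i j))

sumDegSq : ∀ {n} → SimpleGraph n → ℕ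
sumDegSq G = sumFin (λ i → degree G i * degree G i)

sumEdges : ∀ {n} → SimpleGraph n → (Fin n → Fin n → ℕ) → ℕ
sumEdges G f = sumFin (λ i → sumFin (λ j →
  if does (toℕ i <? toℕ j) then (if adj G i j then f i j else 0) else 0))

edgeCount : ∀ {n} → SimpleGraph n → ℕ
edgeCount G = sumEdges G (λ _ _ → 1)

-- A linear arrangement is a bijection π : V → positions (Fin n, i.e. 0..n-1;
-- shifting to 1..n does not change edge lengths).
LinearArrangement : ℕ → Set
LinearArrangement n = Permutation′ n

D : ∀ {n} → SimpleGraph n → LinearArrangement n → ℕ
D G π = sumEdges G (λ u v → ∣ toℕ (π ⟨$⟩ʳ u) - toℕ (π ⟨$⟩ʳ v) ∣)

-- Around a vertex u, its k_u neighbours occupy k_u distinct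
-- positions, and the t-th farthest of them is at distance at most n − t from u, so the edges at u
-- have total length at most n k_u − k_u (k_u + 1)/2. Summing over u counts every edge twice:
-- 2D ≤ 2nm − (Σ k_u² + 2m)/2, which is the claimed 4D ≤ m(4n − 2) − Σ k_u².
module Submission where

open import Defs

module NaturalBound where

  open import Data.Bool using (Bool; true; false; if_then_else_)
  open import Data.Fin using (Fin; toℕ; inject₁; fromℕ) renaming (zero to fzero; suc to fsuc)
  open import Data.Fin.Properties using (toℕ<n; toℕ-inject₁; toℕ-fromℕ; toℕ-injective)
  open import Data.Fin.Permutation using (Permutation′; _⟨$⟩ʳ_; _⟨$⟩ˡ_; inverseˡ)
  open import Data.List using ([]; _∷_)
  open import Data.Nat
  open import Data.Nat.Properties
  open import Data.Nat.Tactic.RingSolver using (solve)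
  open import Function using (_∘_)
  open import Relation.Binary.Definitions using (tri<; tri≈; tri>)
  open import Relation.Binary.PropositionalEquality
  open import Relation.Nullary using (does; ¬_)
  open import Relation.Nullary.Decidable using (dec-true; dec-false)

  open import Algebra.Properties.Semiring.Sum +-*-semiring
    using (sum; sum-cong-≗; sum-init-last; ∑-distrib-+; ∑-comm; ∑-permute; *-distribˡ-sum)

  -- b marks a set of positions on a line of length n; p may be marked too (at distance 0).
  distanceSum : ∀ {n} → Fin n → (Fin n → Bool) → ℕ
  distanceSum p b = sum λ q → if b q then ∣ toℕ p - toℕ q ∣ else 0

  count : ∀ {n} → (Fin n → Bool) → ℕ
  count b = sum (𝟙 ∘ b)

  extend-bound : ∀ {n d S K} x → d ≤ n → 2 * S + K * K + K ≤ 2 * n * K →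
    2 * ((if x then d else 0) + S) + (𝟙 x + K) * (𝟙 x + K) + (𝟙 x + K) ≤ 2 * suc n * (𝟙 x + K)
  extend-bound {n} {K = K} false _ ih = ≤-trans ih (*-monoˡ-≤ K (*-monoʳ-≤ 2 (n≤1+n n)))
  extend-bound {n} {d} {S} {K} true d≤n ih = begin
    2 * (d + S) + suc K * suc K + suc K        ≡⟨ solve (d ∷ S ∷ K ∷ []) ⟩
    (2 * S + K * K + K) + 2 * (d + K + 1)      ≤⟨ +-mono-≤ ih (*-monoʳ-≤ 2 (+-monoˡ-≤ 1 (+-monoˡ-≤ K d≤n))) ⟩
    2 * n * K + 2 * (n + K + 1)                ≡⟨ solve (n ∷ K ∷ []) ⟩
    2 * suc n * suc K                          ∎
    where open ≤-Reasoning

  sum-last : ∀ {n} (f : Fin (suc n) → ℕ) → sum f ≡ f (fromℕ n) + sum (f ∘ inject₁)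
  sum-last f = trans (sum-init-last f) (+-comm (sum (f ∘ inject₁)) (f (fromℕ _)))

  distanceSum-last : ∀ {n} (b : Fin (suc (suc n)) → Bool) →
    distanceSum fzero b ≡ (if b (fromℕ (suc n)) then suc n else 0) + distanceSum fzero (b ∘ inject₁)
  distanceSum-last {n} b = begin
    sum (λ q → if b q then toℕ q else 0)
      ≡⟨ sum-last (λ q → if b q then toℕ q else 0) ⟩
    (if b (fromℕ (suc n)) then toℕ (fromℕ (suc n)) else 0)
      + sum (λ q → if b (inject₁ q) then toℕ (inject₁ q) else 0)
      ≡⟨ cong₂ _+_ (cong (λ d → if b (fromℕ (suc n)) then d else 0) (toℕ-fromℕ (suc n)))
                   (sum-cong-≗ λ q → cong (λ d → if b (inject₁ q) then d else 0) (toℕ-inject₁ q)) ⟩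
    (if b (fromℕ (suc n)) then suc n else 0) + distanceSum fzero (b ∘ inject₁) ∎
    where open ≡-Reasoning

  -- Remove an end position of the line other than p; it lies at distance at most n − 1 from p.
  distanceSum-bound : ∀ {n} (b : Fin n → Bool) (p : Fin n) →
    2 * distanceSum p b + count b * count b + count b ≤ 2 * n * count b
  distanceSum-bound {suc zero} b fzero with b fzero
  ... | true  = ≤-refl
  ... | false = ≤-refl
  distanceSum-bound {suc n} b (fsuc p) =
    extend-bound (b fzero) (toℕ<n p) (distanceSum-bound (b ∘ fsuc) p)
  distanceSum-bound {suc (suc n)} b fzero =
    subst₂ (λ S K → 2 * S + K * K + K ≤ 2 * suc (suc n) * K)
      (sym (distanceSum-last b)) (sym (sum-last (𝟙 ∘ b)))
      (extend-bound (b (fromℕ (suc n))) ≤-refl (distanceSum-bound (b ∘ inject₁) fzero))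

  sumFin≡sum : ∀ {n} (f : Fin n → ℕ) → sumFin f ≡ sum f
  sumFin≡sum {zero}  f = refl
  sumFin≡sum {suc n} f = cong (f fzero +_) (sumFin≡sum (f ∘ fsuc))

  sum-mono-≤ : ∀ {n} {f g : Fin n → ℕ} → (∀ i → f i ≤ g i) → sum f ≤ sum g
  sum-mono-≤ {zero}  f≤g = z≤n
  sum-mono-≤ {suc n} f≤g = +-mono-≤ (f≤g fzero) (sum-mono-≤ (f≤g ∘ fsuc))

  sum-relabel : ∀ {n} (π : Permutation′ n) (c : Fin n → Fin n → ℕ) →
    sum (λ q → c (π ⟨$⟩ˡ q) q) ≡ sum (λ j → c j (π ⟨$⟩ʳ j))
  sum-relabel π c = trans (∑-permute (λ q → c (π ⟨$⟩ˡ q) q) π)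
    (sum-cong-≗ λ j → cong (λ i → c i (π ⟨$⟩ʳ j)) (inverseˡ π))

  whenBefore : ∀ {n} → Fin n → Fin n → ℕ → ℕ
  whenBefore i j x = if does (toℕ i <? toℕ j) then x else 0

  whenBefore-< : ∀ {n} {i j : Fin n} {x} → toℕ i < toℕ j → whenBefore i j x ≡ x
  whenBefore-< {i = i} {j} {x} i<j = cong (λ c → if c then x else 0) (dec-true (toℕ i <? toℕ j) i<j)

  whenBefore-≮ : ∀ {n} {i j : Fin n} {x} → ¬ toℕ i < toℕ j → whenBefore i j x ≡ 0
  whenBefore-≮ {i = i} {j} {x} i≮j = cong (λ c → if c then x else 0) (dec-false (toℕ i <? toℕ j) i≮j)

  split-by-order : ∀ {n} (i j : Fin n) x → (i ≡ j → x ≡ 0) → x ≡ whenBefore i j x + whenBefore j i x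
  split-by-order i j x diagonal with <-cmp (toℕ i) (toℕ j)
  ... | tri< i<j _ j≮i = sym (trans (cong₂ _+_ (whenBefore-< i<j) (whenBefore-≮ j≮i)) (+-identityʳ x))
  ... | tri≈ i≮j i≡j j≮i =
    trans (diagonal (toℕ-injective i≡j)) (sym (cong₂ _+_ (whenBefore-≮ i≮j) (whenBefore-≮ j≮i)))
  ... | tri> i≮j _ j<i = sym (cong₂ _+_ (whenBefore-≮ i≮j) (whenBefore-< j<i))

  sum-symmetric≡2*sum-ordered : ∀ {n} (h : Fin n → Fin n → ℕ) →
    (∀ i j → h i j ≡ h j i) → (∀ i → h i i ≡ 0) →
    sum (λ i → sum (λ j → h i j)) ≡ 2 * sum (λ i → sum (λ j → whenBefore i j (h i j)))
  sum-symmetric≡2*sum-ordered {n} h symmetric diagonal = begin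
    sum (λ i → sum (λ j → h i j))
      ≡⟨ sum-cong-≗ (λ i → sum-cong-≗ λ j → split-by-order i j (h i j) λ { refl → diagonal i }) ⟩
    sum (λ i → sum (λ j → whenBefore i j (h i j) + whenBefore j i (h i j)))
      ≡⟨ sum-cong-≗ (λ i → ∑-distrib-+ (λ j → whenBefore i j (h i j)) (λ j → whenBefore j i (h i j))) ⟩
    sum (λ i → sum (λ j → whenBefore i j (h i j)) + sum (λ j → whenBefore j i (h i j)))
      ≡⟨ ∑-distrib-+ (λ i → sum (λ j → whenBefore i j (h i j)))
                     (λ i → sum (λ j → whenBefore j i (h i j))) ⟩
    ordered + sum (λ i → sum (λ j → whenBefore j i (h i j)))
      ≡⟨ cong (ordered +_) (∑-comm (λ i j → whenBefore j i (h i j))) ⟩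
    ordered + sum (λ j → sum (λ i → whenBefore j i (h i j)))
      ≡⟨ cong (ordered +_) (sum-cong-≗ λ j → sum-cong-≗ λ i → cong (whenBefore j i) (symmetric i j)) ⟩
    ordered + ordered
      ≡⟨ cong (ordered +_) (sym (+-identityʳ ordered)) ⟩
    2 * ordered ∎
    where
    open ≡-Reasoning
    ordered : ℕ
    ordered = sum (λ i → sum (λ j → whenBefore i j (h i j)))

  𝟙≡if : ∀ b → 𝟙 b ≡ (if b then 1 else 0)
  𝟙≡if true  = refl
  𝟙≡if false = refl

  module _ {n} (G : SimpleGraph n) where

    adjacentSum : (Fin n → Fin n → ℕ) → Fin n → ℕ
    adjacentSum f u = sum λ v → if adj G u v then f u v else 0

    sum-adjacentSum : ∀ f → (∀ u v → f u v ≡ f v u) → sum (adjacentSum f) ≡ 2 * sumEdges G f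
    sum-adjacentSum f f-symmetric = begin
      sum (λ u → sum (λ v → h u v))
        ≡⟨ sum-symmetric≡2*sum-ordered h
             (λ u v → cong₂ (λ a x → if a then x else 0) (symmetric G u v) (f-symmetric u v))
             (λ u → cong (λ a → if a then f u u else 0) (irrefl G u)) ⟩
      2 * sum (λ u → sum (λ v → whenBefore u v (h u v)))
        ≡⟨ cong (2 *_) (sum-cong-≗ λ u → sym (sumFin≡sum (λ v → whenBefore u v (h u v)))) ⟩
      2 * sum (λ u → sumFin (λ v → whenBefore u v (h u v)))
        ≡⟨ cong (2 *_) (sym (sumFin≡sum (λ u → sumFin (λ v → whenBefore u v (h u v))))) ⟩
      2 * sumEdges G f ∎
      where
      open ≡-Reasoning
      h : Fin n → Fin n → ℕ
      h u v = if adj G u v then f u v else 0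

    degree≡adjacentSum : ∀ u → degree G u ≡ adjacentSum (λ _ _ → 1) u
    degree≡adjacentSum u = trans (sumFin≡sum (𝟙 ∘ adj G u)) (sum-cong-≗ (𝟙≡if ∘ adj G u))

    handshake : sum (degree G) ≡ 2 * edgeCount G
    handshake = trans (sum-cong-≗ degree≡adjacentSum) (sum-adjacentSum (λ _ _ → 1) (λ _ _ → refl))

    module _ (π : LinearArrangement n) where

      edgeLength : Fin n → Fin n → ℕ
      edgeLength u v = ∣ toℕ (π ⟨$⟩ʳ u) - toℕ (π ⟨$⟩ʳ v) ∣

      sum-adjacentLengths : sum (adjacentSum edgeLength) ≡ 2 * D G π
      sum-adjacentLengths = sum-adjacentSum edgeLength λ u v → ∣-∣-comm (toℕ (π ⟨$⟩ʳ u)) _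

      vertex-bound : ∀ u →
        2 * adjacentSum edgeLength u + degree G u * degree G u + degree G u ≤ 2 * n * degree G u
      vertex-bound u = subst₂ (λ S K → 2 * S + K * K + K ≤ 2 * n * K)
        (sum-relabel π λ v q → if adj G u v then ∣ toℕ (π ⟨$⟩ʳ u) - toℕ q ∣ else 0)
        (trans (sum-relabel π λ v _ → 𝟙 (adj G u v)) (sym (sumFin≡sum (𝟙 ∘ adj G u))))
        (distanceSum-bound (adj G u ∘ (π ⟨$⟩ˡ_)) (π ⟨$⟩ʳ u))

      D-bound : 2 * (2 * D G π) + (sumDegSq G + 2 * edgeCount G) ≤ 2 * n * (2 * edgeCount G)
      D-bound = begin
        2 * (2 * D G π) + (sumDegSq G + 2 * edgeCount G)
          ≡⟨ cong₂ (λ S Q → 2 * S + (Q + 2 * edgeCount G))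
                   (sym sum-adjacentLengths) (sumFin≡sum (λ u → k u * k u)) ⟩
        2 * sum L + (sum (λ u → k u * k u) + 2 * edgeCount G)
          ≡⟨ cong₂ (λ A M → A + (sum (λ u → k u * k u) + M)) (*-distribˡ-sum 2 L) (sym handshake) ⟩
        sum (λ u → 2 * L u) + (sum (λ u → k u * k u) + sum k)
          ≡⟨ sym (+-assoc (sum (λ u → 2 * L u)) (sum (λ u → k u * k u)) (sum k)) ⟩
        sum (λ u → 2 * L u) + sum (λ u → k u * k u) + sum k
          ≡⟨ cong (_+ sum k) (sym (∑-distrib-+ (λ u → 2 * L u) (λ u → k u * k u))) ⟩
        sum (λ u → 2 * L u + k u * k u) + sum k
          ≡⟨ sym (∑-distrib-+ (λ u → 2 * L u + k u * k u) k) ⟩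
        sum (λ u → 2 * L u + k u * k u + k u)
          ≤⟨ sum-mono-≤ vertex-bound ⟩
        sum (λ u → 2 * n * k u)
          ≡⟨ sym (*-distribˡ-sum (2 * n) k) ⟩
        2 * n * sum k
          ≡⟨ cong (2 * n *_) handshake ⟩
        2 * n * (2 * edgeCount G) ∎
        where
        open ≤-Reasoning
        L : Fin n → ℕ
        L = adjacentSum edgeLength
        k : Fin n → ℕ
        k = degree G

open NaturalBound using (D-bound)

open import Data.Nat using (ℕ; _≥_)
open import Data.Integer using (ℤ; +_; _-_; _*_; _≤_)
import Data.Nat as ℕ
open import Data.Integer using (_+_; -_; +≤+)
open import Data.Integer.Properties using (pos-+; pos-*; +-monoˡ-≤; module ≤-Reasoning)
open import Data.Integer.Tactic.RingSolver using (solve)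
open import Data.List using ([]; _∷_)
open import Relation.Binary.PropositionalEquality using (_≡_; trans; cong; cong₂; subst₂)

bound-rearranged : ∀ (d s m n : ℤ) → + 2 * (+ 2 * d) + (s + + 2 * m) ≤ + 2 * n * (+ 2 * m) →
  + 4 * d ≤ m * (+ 4 * n - + 2) - s
bound-rearranged d s m n h = begin
  + 4 * d                                          ≡⟨ solve (d ∷ s ∷ m ∷ []) ⟩
  + 2 * (+ 2 * d) + (s + + 2 * m) - (s + + 2 * m)  ≤⟨ +-monoˡ-≤ (- (s + + 2 * m)) h ⟩
  + 2 * n * (+ 2 * m) - (s + + 2 * m)              ≡⟨ solve (s ∷ m ∷ n ∷ []) ⟩
  m * (+ 4 * n - + 2) - s                          ∎
  where open ≤-Reasoning

bound-rearranged-ℕ : ∀ d s m n → 2 ℕ.* (2 ℕ.* d) ℕ.+ (s ℕ.+ 2 ℕ.* m) ℕ.≤ 2 ℕ.* n ℕ.* (2 ℕ.* m) →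
  + 4 * + d ≤ + m * (+ 4 * + n - + 2) - + s
bound-rearranged-ℕ d s m n h =
  bound-rearranged (+ d) (+ s) (+ m) (+ n) (subst₂ _≤_ cast-lhs cast-rhs (+≤+ h))
  where
  cast-lhs : + (2 ℕ.* (2 ℕ.* d) ℕ.+ (s ℕ.+ 2 ℕ.* m)) ≡ + 2 * (+ 2 * + d) + (+ s + + 2 * + m)
  cast-lhs = trans (pos-+ (2 ℕ.* (2 ℕ.* d)) (s ℕ.+ 2 ℕ.* m))
    (cong₂ _+_ (trans (pos-* 2 (2 ℕ.* d)) (cong (+ 2 *_) (pos-* 2 d)))
               (trans (pos-+ s (2 ℕ.* m)) (cong (_+_ (+ s)) (pos-* 2 m))))
  cast-rhs : + (2 ℕ.* n ℕ.* (2 ℕ.* m)) ≡ + 2 * + n * (+ 2 * + m)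
  cast-rhs = trans (pos-* (2 ℕ.* n) (2 ℕ.* m)) (cong₂ _*_ (pos-* 2 n) (pos-* 2 m))

mainTheorem10 : (n : ℕ) → n ≥ 1 → (G : SimpleGraph n) → (π : LinearArrangement n) →
    + 4 * + D G π ≤ + edgeCount G * (+ 4 * + n - + 2) - + sumDegSq G
mainTheorem10 n _ G π = bound-rearranged-ℕ (D G π) (sumDegSq G) (edgeCount G) n (D-bound G π)
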